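{- Let $p$ be an odd prime, let $H,N$ be integers with $0\le H<H+N<p$, and let $\ell\ge1$ be a fixed integer. Let $I_\ell(H,N)$ denote the number of solutions of the congruence $$\prod_{i=1}^{\ell}n_i!\equiv\prod_{i=\ell+1}^{2\ell}n_i!\pmod p,\qquad H+1\le n_1,\dots,n_{2\ell}\le H+N.$$ Then $$I_\ell(H,N)\ll N^{2\ell-1+2^{ -\ell}}.$$
   Context: The implied constant may depend on $\ell$ but not on $p,H,N$. -}

module Defs where

open import Data.Nat using (ℕ; zero; suc; _+_; _≟_; NonZero)
open import Data.Nat.DivMod using (_%_)
open import Data.Nat using (_!)
open import Data.Nat.ListAction using (product)
open import Data.List using (List; []; _∷_; map; length; filter; cartesianProduct; upTo; concatMap)
open import Data.Product using (_×_; _,_; proj₁; proj₂)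

tuples : ℕ → List ℕ → List (List ℕ)
tuples zero    xs = [] ∷ []
tuples (suc k) xs = concatMap (λ x → map (x ∷_) (tuples k xs)) xs

interval : ℕ → ℕ → List ℕ
interval H N = map (λ i → H + suc i) (upTo N)

prodFact : List ℕ → ℕ
prodFact xs = product (map (λ n → n !) xs)

I : (ℓ p H N : ℕ) → .{{NonZero p}} → ℕ
I ℓ p H N = length (filter (λ pr → prodFact (proj₁ pr) % p ≟ prodFact (proj₂ pr) % p)
                           (cartesianProduct T T))
  where T = tuples ℓ (interval H N)

{-# OPTIONS --safe #-}
module Submission where

-- I_ℓ(H,N) counts pairs of products x, y of ℓ factorials n! (H < n ≤ H + N) with x ≡ y (mod p), so it
-- is the sum over residues l of the squared multiplicity of l. For ℓ + 1 factors that multiplicity is a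
-- sum over the last factor n. Splitting the n-range into m blocks of length K and applying Cauchy–Schwarz
-- over the blocks leaves only pairs n, n′ from a common block. The diagonal n = n′ contributes N · I_ℓ
-- since n! is invertible mod p. For n′ = n + d with 0 < d < K the congruence n! x ≡ n′! y says
-- y (n+1)⋯(n+d) ≡ x, a polynomial congruence of degree d in n with at most d solutions, so these pairs
-- contribute at most 2 K² N^(2ℓ). Hence I_(ℓ+1) ≤ (N/K + 1)(N · I_ℓ + 2 K² N^(2ℓ)); taking
-- K ≈ N^(2^-(ℓ+1)) and inducting from I_0 = 1 gives I_ℓ ≪ N^(2ℓ - 1 + 2^-ℓ).

module FiniteSums where

  open import Data.Nat
  open import Data.Nat.Properties
  open import Data.Nat.Tactic.RingSolver using (solve-∀)
  open import Data.List using (List; []; _∷_; _++_; map; concatMap; filter; length; cartesianProduct; applyUpTo)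
  open import Data.Product using (_,_)
  open import Data.Sum using (inj₁; inj₂)
  open import Data.Bool using (if_then_else_)
  open import Relation.Nullary using (Dec; yes; no; does; ¬_)
  open import Relation.Nullary.Decidable using (_×-dec_)
  open import Relation.Nullary.Negation using (contradiction)
  open import Relation.Unary using (Pred; Decidable)
  open import Relation.Binary.PropositionalEquality
  open ≤-Reasoning

  𝟙 : ∀ {a} {A : Set a} → Dec A → ℕ
  𝟙 A? = if does A? then 1 else 0

  𝟙≤1 : ∀ {a} {A : Set a} (A? : Dec A) → 𝟙 A? ≤ 1
  𝟙≤1 (yes _) = ≤-refl
  𝟙≤1 (no _)  = z≤n

  𝟙-yes : ∀ {a} {A : Set a} (A? : Dec A) → A → 𝟙 A? ≡ 1
  𝟙-yes (yes _) _ = refl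
  𝟙-yes (no ¬a) a = contradiction a ¬a

  𝟙-no : ∀ {a} {A : Set a} (A? : Dec A) → ¬ A → 𝟙 A? ≡ 0
  𝟙-no (yes a) ¬a = contradiction a ¬a
  𝟙-no (no _)  _  = refl

  𝟙-× : ∀ {a b} {A : Set a} {B : Set b} (A? : Dec A) (B? : Dec B) → 𝟙 (A? ×-dec B?) ≡ 𝟙 A? * 𝟙 B?
  𝟙-× (yes _) (yes _) = refl
  𝟙-× (yes _) (no _)  = refl
  𝟙-× (no _)  _       = refl

  𝟙-mono : ∀ {a b} {A : Set a} {B : Set b} (A? : Dec A) (B? : Dec B) → (A → B) → 𝟙 A? ≤ 𝟙 B?
  𝟙-mono (yes a) (yes _) _   = ≤-refl
  𝟙-mono (yes a) (no ¬b) A→B = contradiction (A→B a) ¬b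
  𝟙-mono (no _)  _       _   = z≤n

  𝟙*𝟙≡𝟙 : ∀ {a} {A : Set a} (A? : Dec A) → 𝟙 A? * 𝟙 A? ≡ 𝟙 A?
  𝟙*𝟙≡𝟙 (yes _) = refl
  𝟙*𝟙≡𝟙 (no _)  = refl

  𝟙*-monoʳ : ∀ {a} {A : Set a} (A? : Dec A) {m n} → (A → m ≤ n) → 𝟙 A? * m ≤ 𝟙 A? * n
  𝟙*-monoʳ (yes a) m≤n = +-monoˡ-≤ 0 (m≤n a)
  𝟙*-monoʳ (no _)  _   = z≤n

  δ : ℕ → ℕ → ℕ
  δ m n = 𝟙 (m ≟ n)

  δ-refl : ∀ n → δ n n ≡ 1
  δ-refl n = 𝟙-yes (n ≟ n) refl

  δ-sym : ∀ m n → δ m n ≡ δ n m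
  δ-sym m n = ≤-antisym (𝟙-mono (m ≟ n) (n ≟ m) sym) (𝟙-mono (n ≟ m) (m ≟ n) sym)

  ∑ᴸ : ∀ {a} {A : Set a} → List A → (A → ℕ) → ℕ
  ∑ᴸ []       f = 0
  ∑ᴸ (x ∷ xs) f = f x + ∑ᴸ xs f

  syntax ∑ᴸ xs (λ x → e) = ∑[ x ∈ xs ] e

  ∑ : ℕ → (ℕ → ℕ) → ℕ
  ∑ zero    f = 0
  ∑ (suc n) f = f 0 + ∑ n (λ i → f (suc i))

  syntax ∑ n (λ i → e) = ∑[ i < n ] e

  module _ {a} {A : Set a} where

    ∑ᴸ-cong : ∀ (xs : List A) {f g : A → ℕ} → (∀ x → f x ≡ g x) → ∑ᴸ xs f ≡ ∑ᴸ xs g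
    ∑ᴸ-cong []       f≗g = refl
    ∑ᴸ-cong (x ∷ xs) f≗g = cong₂ _+_ (f≗g x) (∑ᴸ-cong xs f≗g)

    ∑ᴸ-mono : ∀ (xs : List A) {f g : A → ℕ} → (∀ x → f x ≤ g x) → ∑ᴸ xs f ≤ ∑ᴸ xs g
    ∑ᴸ-mono []       f≤g = z≤n
    ∑ᴸ-mono (x ∷ xs) f≤g = +-mono-≤ (f≤g x) (∑ᴸ-mono xs f≤g)

    ∑ᴸ-zero : ∀ (xs : List A) → ∑[ x ∈ xs ] 0 ≡ 0
    ∑ᴸ-zero []       = refl
    ∑ᴸ-zero (_ ∷ xs) = ∑ᴸ-zero xs

    ∑ᴸ-distrib-+ : ∀ (xs : List A) (f g : A → ℕ) → ∑[ x ∈ xs ] (f x + g x) ≡ ∑ᴸ xs f + ∑ᴸ xs g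
    ∑ᴸ-distrib-+ []       f g = refl
    ∑ᴸ-distrib-+ (x ∷ xs) f g = begin-equality
      f x + g x + ∑[ x ∈ xs ] (f x + g x)   ≡⟨ cong (f x + g x +_) (∑ᴸ-distrib-+ xs f g) ⟩
      f x + g x + (∑ᴸ xs f + ∑ᴸ xs g)       ≡⟨ +-assoc-middle (f x) (g x) _ _ ⟩
      f x + ∑ᴸ xs f + (g x + ∑ᴸ xs g)       ∎
      where
      +-assoc-middle : ∀ a b c d → a + b + (c + d) ≡ a + c + (b + d)
      +-assoc-middle = solve-∀

    ∑ᴸ-distribˡ-* : ∀ (xs : List A) c (f : A → ℕ) → ∑[ x ∈ xs ] (c * f x) ≡ c * ∑ᴸ xs f
    ∑ᴸ-distribˡ-* []       c f = sym (*-zeroʳ c)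
    ∑ᴸ-distribˡ-* (x ∷ xs) c f = trans (cong (c * f x +_) (∑ᴸ-distribˡ-* xs c f)) (sym (*-distribˡ-+ c (f x) _))

    ∑ᴸ-distribʳ-* : ∀ (xs : List A) c (f : A → ℕ) → ∑[ x ∈ xs ] (f x * c) ≡ ∑ᴸ xs f * c
    ∑ᴸ-distribʳ-* xs c f = begin-equality
      ∑[ x ∈ xs ] (f x * c)  ≡⟨ ∑ᴸ-cong xs (λ x → *-comm (f x) c) ⟩
      ∑[ x ∈ xs ] (c * f x)  ≡⟨ ∑ᴸ-distribˡ-* xs c f ⟩
      c * ∑ᴸ xs f            ≡⟨ *-comm c _ ⟩
      ∑ᴸ xs f * c            ∎

    ∑ᴸ-++ : ∀ (xs ys : List A) f → ∑ᴸ (xs ++ ys) f ≡ ∑ᴸ xs f + ∑ᴸ ys f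
    ∑ᴸ-++ []       ys f = refl
    ∑ᴸ-++ (x ∷ xs) ys f = trans (cong (f x +_) (∑ᴸ-++ xs ys f)) (sym (+-assoc (f x) _ _))

    length-filter : ∀ {p} {P : Pred A p} (P? : Decidable P) xs → length (filter P? xs) ≡ ∑[ x ∈ xs ] 𝟙 (P? x)
    length-filter P? []       = refl
    length-filter P? (x ∷ xs) with P? x
    ... | yes _ = cong suc (length-filter P? xs)
    ... | no _  = length-filter P? xs

  module _ {a b} {A : Set a} {B : Set b} where

    ∑ᴸ-map : ∀ (g : A → B) xs f → ∑ᴸ (map g xs) f ≡ ∑[ x ∈ xs ] f (g x)
    ∑ᴸ-map g []       f = refl
    ∑ᴸ-map g (x ∷ xs) f = cong (f (g x) +_) (∑ᴸ-map g xs f)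

    ∑ᴸ-concatMap : ∀ (g : A → List B) xs f → ∑ᴸ (concatMap g xs) f ≡ ∑[ x ∈ xs ] ∑ᴸ (g x) f
    ∑ᴸ-concatMap g []       f = refl
    ∑ᴸ-concatMap g (x ∷ xs) f = trans (∑ᴸ-++ (g x) _ f) (cong (∑ᴸ (g x) f +_) (∑ᴸ-concatMap g xs f))

  ∑ᴸ-cartesianProduct : ∀ {a b} {A : Set a} {B : Set b} (xs : List A) (ys : List B) f →
                        ∑ᴸ (cartesianProduct xs ys) f ≡ ∑[ x ∈ xs ] ∑[ y ∈ ys ] f (x , y)
  ∑ᴸ-cartesianProduct []       ys f = refl
  ∑ᴸ-cartesianProduct (x ∷ xs) ys f = trans (∑ᴸ-++ (map (x ,_) ys) _ f)
    (cong₂ _+_ (∑ᴸ-map (x ,_) ys f) (∑ᴸ-cartesianProduct xs ys f))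

  ∑ᴸ-applyUpTo : ∀ {a} {A : Set a} (g : ℕ → A) n f → ∑ᴸ (applyUpTo g n) f ≡ ∑[ i < n ] f (g i)
  ∑ᴸ-applyUpTo g zero    f = refl
  ∑ᴸ-applyUpTo g (suc n) f = cong (f (g 0) +_) (∑ᴸ-applyUpTo (λ i → g (suc i)) n f)

  ∑-cong : ∀ n {f g : ℕ → ℕ} → (∀ i → i < n → f i ≡ g i) → ∑ n f ≡ ∑ n g
  ∑-cong zero    f≗g = refl
  ∑-cong (suc n) f≗g = cong₂ _+_ (f≗g 0 z<s) (∑-cong n (λ i i<n → f≗g (suc i) (s<s i<n)))

  ∑-mono : ∀ n {f g : ℕ → ℕ} → (∀ i → i < n → f i ≤ g i) → ∑ n f ≤ ∑ n g
  ∑-mono zero    f≤g = z≤n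
  ∑-mono (suc n) f≤g = +-mono-≤ (f≤g 0 z<s) (∑-mono n (λ i i<n → f≤g (suc i) (s<s i<n)))

  ∑-distrib-+ : ∀ n (f g : ℕ → ℕ) → ∑[ i < n ] (f i + g i) ≡ ∑ n f + ∑ n g
  ∑-distrib-+ zero    f g = refl
  ∑-distrib-+ (suc n) f g = begin-equality
    f 0 + g 0 + ∑[ i < n ] (f (suc i) + g (suc i))        ≡⟨ cong (f 0 + g 0 +_) (∑-distrib-+ n _ _) ⟩
    f 0 + g 0 + (∑[ i < n ] f (suc i) + ∑[ i < n ] g (suc i)) ≡⟨ +-assoc-middle (f 0) (g 0) _ _ ⟩
    f 0 + ∑[ i < n ] f (suc i) + (g 0 + ∑[ i < n ] g (suc i)) ∎
    where
    +-assoc-middle : ∀ a b c d → a + b + (c + d) ≡ a + c + (b + d)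
    +-assoc-middle = solve-∀

  ∑-distribˡ-* : ∀ n c (f : ℕ → ℕ) → ∑[ i < n ] (c * f i) ≡ c * ∑ n f
  ∑-distribˡ-* zero    c f = sym (*-zeroʳ c)
  ∑-distribˡ-* (suc n) c f = trans (cong (c * f 0 +_) (∑-distribˡ-* n c _)) (sym (*-distribˡ-+ c (f 0) _))

  ∑-distribʳ-* : ∀ n c (f : ℕ → ℕ) → ∑[ i < n ] (f i * c) ≡ ∑ n f * c
  ∑-distribʳ-* n c f = begin-equality
    ∑[ i < n ] (f i * c)  ≡⟨ ∑-cong n (λ i _ → *-comm (f i) c) ⟩
    ∑[ i < n ] (c * f i)  ≡⟨ ∑-distribˡ-* n c f ⟩
    c * ∑ n f             ≡⟨ *-comm c _ ⟩
    ∑ n f * c             ∎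

  ∑-const : ∀ n c → ∑[ i < n ] c ≡ n * c
  ∑-const zero    c = refl
  ∑-const (suc n) c = cong (c +_) (∑-const n c)

  ∑-zero : ∀ n → ∑[ i < n ] 0 ≡ 0
  ∑-zero n = trans (∑-const n 0) (*-zeroʳ n)

  ∑-comm : ∀ m n (f : ℕ → ℕ → ℕ) → ∑[ i < m ] ∑[ j < n ] f i j ≡ ∑[ j < n ] ∑[ i < m ] f i j
  ∑-comm zero    n f = sym (∑-zero n)
  ∑-comm (suc m) n f = trans (cong (∑[ j < n ] f 0 j +_) (∑-comm m n (λ i → f (suc i)))) (sym (∑-distrib-+ n _ _))

  ∑-∑ᴸ-comm : ∀ {a} {A : Set a} n (xs : List A) (f : ℕ → A → ℕ) →
              ∑[ i < n ] ∑[ x ∈ xs ] f i x ≡ ∑[ x ∈ xs ] ∑[ i < n ] f i x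
  ∑-∑ᴸ-comm zero    xs f = sym (∑ᴸ-zero xs)
  ∑-∑ᴸ-comm (suc n) xs f = trans (cong (∑ᴸ xs (f 0) +_) (∑-∑ᴸ-comm n xs (λ i → f (suc i)))) (sym (∑ᴸ-distrib-+ xs _ _))

  ∑-+ : ∀ m n f → ∑ (m + n) f ≡ ∑ m f + ∑[ j < n ] f (m + j)
  ∑-+ zero    n f = refl
  ∑-+ (suc m) n f = trans (cong (f 0 +_) (∑-+ m n (λ i → f (suc i)))) (sym (+-assoc (f 0) _ _))

  ∑-* : ∀ m K f → ∑ (m * K) f ≡ ∑[ b < m ] ∑[ t < K ] f (b * K + t)
  ∑-* zero    K f = refl
  ∑-* (suc m) K f = begin-equality
    ∑ (K + m * K) f                                        ≡⟨ ∑-+ K (m * K) f ⟩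
    ∑ K f + ∑[ j < m * K ] f (K + j)                       ≡⟨ cong (∑ K f +_) (∑-* m K (λ j → f (K + j))) ⟩
    ∑ K f + ∑[ b < m ] ∑[ t < K ] f (K + (b * K + t))      ≡⟨ cong (∑ K f +_) (∑-cong m (λ b _ → ∑-cong K (λ t _ →
                                                                cong f (sym (+-assoc K (b * K) t))))) ⟩
    ∑ K f + ∑[ b < m ] ∑[ t < K ] f (K + b * K + t)        ∎

  ∑-monoˡ : ∀ {m n} f → m ≤ n → ∑ m f ≤ ∑ n f
  ∑-monoˡ {m} f m≤n with m≤n⇒∃[o]m+o≡n m≤n
  ... | o , refl = ≤-trans (m≤m+n (∑ m f) _) (≤-reflexive (sym (∑-+ m o f)))

  ∑-truncate : ∀ {N M} f → N ≤ M → ∑ N f ≡ ∑[ i < M ] (𝟙 (i <? N) * f i)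
  ∑-truncate {N} f N≤M with m≤n⇒∃[o]m+o≡n N≤M
  ... | k , refl = sym (begin-equality
    ∑[ i < N + k ] (𝟙 (i <? N) * f i)
      ≡⟨ ∑-+ N k _ ⟩
    ∑[ i < N ] (𝟙 (i <? N) * f i) + ∑[ j < k ] (𝟙 (N + j <? N) * f (N + j))
      ≡⟨ cong₂ _+_ (∑-cong N (λ i i<N → trans (cong (_* f i) (𝟙-yes (i <? N) i<N)) (+-identityʳ (f i))))
                   (trans (∑-cong k (λ j _ → cong (_* f (N + j)) (𝟙-no (N + j <? N) (m+n≮m N j)))) (∑-zero k)) ⟩
    ∑ N f + 0
      ≡⟨ +-identityʳ _ ⟩
    ∑ N f ∎)

  ∑-𝟙-< : ∀ M N → ∑[ i < M ] 𝟙 (i <? N) ≤ N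
  ∑-𝟙-< zero    N       = z≤n
  ∑-𝟙-< (suc M) zero    = ≤-reflexive (∑-zero M)
  ∑-𝟙-< (suc M) (suc N) = s≤s (∑-𝟙-< M N)

  ∑-δ : ∀ n r (f : ℕ → ℕ) → r < n → ∑[ l < n ] (δ r l * f l) ≡ f r
  ∑-δ (suc n) zero    f _         = trans (cong₂ _+_ (+-identityʳ (f 0)) (∑-zero n)) (+-identityʳ (f 0))
  ∑-δ (suc n) (suc r) f (s<s r<n) = ∑-δ n r (λ l → f (suc l)) r<n

  ∑*∑ : ∀ m n (f g : ℕ → ℕ) → ∑ m f * ∑ n g ≡ ∑[ i < m ] ∑[ j < n ] (f i * g j)
  ∑*∑ m n f g = trans (sym (∑-distribʳ-* m (∑ n g) f)) (∑-cong m (λ i _ → sym (∑-distribˡ-* n (f i) g)))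

  2m[m+d]≤m²+[m+d]² : ∀ m d → 2 * (m * (m + d)) ≤ m * m + (m + d) * (m + d)
  2m[m+d]≤m²+[m+d]² m d = subst (2 * (m * (m + d)) ≤_) (square-sum m d) (m≤m+n _ (d * d))
    where
    square-sum : ∀ m d → 2 * (m * (m + d)) + d * d ≡ m * m + (m + d) * (m + d)
    square-sum = solve-∀

  2mn≤m²+n² : ∀ m n → 2 * (m * n) ≤ m * m + n * n
  2mn≤m²+n² m n with ≤-total m n
  ... | inj₁ m≤n with m≤n⇒∃[o]m+o≡n m≤n
  ...   | d , refl = 2m[m+d]≤m²+[m+d]² m d
  2mn≤m²+n² m n | inj₂ n≤m with m≤n⇒∃[o]m+o≡n n≤m
  ...   | d , refl = subst₂ _≤_ (cong (2 *_) (*-comm n (n + d))) (+-comm (n * n) _) (2m[m+d]≤m²+[m+d]² n d)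

  cauchy-schwarz : ∀ m (g : ℕ → ℕ) → ∑ m g * ∑ m g ≤ m * ∑[ i < m ] (g i * g i)
  cauchy-schwarz zero    g = z≤n
  cauchy-schwarz (suc m) g = begin
    (a + B) * (a + B)                  ≡⟨ expand a B ⟩
    a * a + 2 * (a * B) + B * B        ≤⟨ +-mono-≤ (+-monoʳ-≤ (a * a) cross) (cauchy-schwarz m g′) ⟩
    a * a + (m * (a * a) + Q) + m * Q  ≡⟨ collect a m Q ⟩
    suc m * (a * a + Q)                ∎
    where
    a = g 0
    g′ = λ i → g (suc i)
    B = ∑ m g′
    Q = ∑[ i < m ] (g′ i * g′ i)
    expand : ∀ a B → (a + B) * (a + B) ≡ a * a + 2 * (a * B) + B * B
    expand = solve-∀
    collect : ∀ a m Q → a * a + (m * (a * a) + Q) + m * Q ≡ suc m * (a * a + Q)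
    collect = solve-∀
    cross : 2 * (a * B) ≤ m * (a * a) + Q
    cross = begin
      2 * (a * B)                       ≡⟨ cong (2 *_) (sym (∑-distribˡ-* m a g′)) ⟩
      2 * ∑[ i < m ] (a * g′ i)         ≡⟨ sym (∑-distribˡ-* m 2 _) ⟩
      ∑[ i < m ] (2 * (a * g′ i))       ≤⟨ ∑-mono m (λ i _ → 2mn≤m²+n² a (g′ i)) ⟩
      ∑[ i < m ] (a * a + g′ i * g′ i)  ≡⟨ ∑-distrib-+ m _ _ ⟩
      ∑[ i < m ] (a * a) + Q            ≡⟨ cong (_+ Q) (∑-const m (a * a)) ⟩
      m * (a * a) + Q                   ∎

  ∑-mult*mult≡collisions : ∀ {a b} {A : Set a} {B : Set b} P (xs : List A) (ys : List B) (h : A → ℕ) (k : B → ℕ) →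
    (∀ x → h x < P) →
    ∑[ l < P ] (∑[ x ∈ xs ] δ (h x) l * ∑[ y ∈ ys ] δ (k y) l) ≡ ∑[ x ∈ xs ] ∑[ y ∈ ys ] δ (h x) (k y)
  ∑-mult*mult≡collisions P xs ys h k h<P = begin-equality
    ∑[ l < P ] (∑[ x ∈ xs ] δ (h x) l * ∑[ y ∈ ys ] δ (k y) l)
      ≡⟨ ∑-cong P (λ l _ → trans (sym (∑ᴸ-distribʳ-* xs (∑[ y ∈ ys ] δ (k y) l) (λ x → δ (h x) l)))
                                  (∑ᴸ-cong xs (λ x → sym (∑ᴸ-distribˡ-* ys (δ (h x) l) (λ y → δ (k y) l))))) ⟩
    ∑[ l < P ] ∑[ x ∈ xs ] ∑[ y ∈ ys ] (δ (h x) l * δ (k y) l)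
      ≡⟨ ∑-∑ᴸ-comm P xs _ ⟩
    ∑[ x ∈ xs ] ∑[ l < P ] ∑[ y ∈ ys ] (δ (h x) l * δ (k y) l)
      ≡⟨ ∑ᴸ-cong xs (λ x → ∑-∑ᴸ-comm P ys _) ⟩
    ∑[ x ∈ xs ] ∑[ y ∈ ys ] ∑[ l < P ] (δ (h x) l * δ (k y) l)
      ≡⟨ ∑ᴸ-cong xs (λ x → ∑ᴸ-cong ys (λ y → trans (∑-δ P (h x) (δ (k y)) (h<P x)) (δ-sym (k y) (h x)))) ⟩
    ∑[ x ∈ xs ] ∑[ y ∈ ys ] δ (h x) (k y) ∎

  ∑∑≤band : ∀ {K L} (G : ℕ → ℕ → ℕ) → K ≤ L →
            ∑[ t < K ] ∑[ t′ < K ] G t t′ ≤ ∑[ t < K ] (G t t + ∑[ s < L ] (G t (suc (t + s)) + G (suc (t + s)) t))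
  ∑∑≤band {zero}      G _     = z≤n
  ∑∑≤band {suc K} {L} G 1+K≤L = begin
    G 0 0 + ∑[ j < K ] G 0 (suc j) + ∑[ i < K ] (G (suc i) 0 + ∑[ j < K ] G (suc i) (suc j))
      ≡⟨ cong (G 0 0 + ∑[ j < K ] G 0 (suc j) +_) (∑-distrib-+ K _ _) ⟩
    G 0 0 + ∑[ j < K ] G 0 (suc j) + (∑[ i < K ] G (suc i) 0 + ∑[ i < K ] ∑[ j < K ] G (suc i) (suc j))
      ≤⟨ +-mono-≤ (+-monoʳ-≤ (G 0 0) (∑-monoˡ _ K≤L)) (+-mono-≤ (∑-monoˡ _ K≤L) (∑∑≤band (λ i j → G (suc i) (suc j)) K≤L)) ⟩
    G 0 0 + ∑[ s < L ] G 0 (suc s) + (∑[ s < L ] G (suc s) 0 + R)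
      ≡⟨ reassociate (G 0 0) _ _ R ⟩
    G 0 0 + (∑[ s < L ] G 0 (suc s) + ∑[ s < L ] G (suc s) 0) + R
      ≡⟨ cong (λ z → G 0 0 + z + R) (sym (∑-distrib-+ L _ _)) ⟩
    G 0 0 + ∑[ s < L ] (G 0 (suc s) + G (suc s) 0) + R ∎
    where
    K≤L = ≤-trans (n≤1+n K) 1+K≤L
    R = ∑[ t < K ] (G (suc t) (suc t) + ∑[ s < L ] (G (suc t) (suc (suc (t + s))) + G (suc (suc (t + s))) (suc t)))
    reassociate : ∀ a b c d → a + b + (c + d) ≡ a + (b + c) + d
    reassociate = solve-∀

  blocks≤band : ∀ m K (G : ℕ → ℕ → ℕ) →
    ∑[ b < m ] ∑[ t < K ] ∑[ t′ < K ] G (b * K + t) (b * K + t′) ≤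
    ∑[ i < m * K ] (G i i + ∑[ s < K ] (G i (i + suc s) + G (i + suc s) i))
  blocks≤band m K G = begin
    ∑[ b < m ] ∑[ t < K ] ∑[ t′ < K ] G (b * K + t) (b * K + t′)
      ≤⟨ ∑-mono m (λ b _ → ∑∑≤band {K} (λ t t′ → G (b * K + t) (b * K + t′)) ≤-refl) ⟩
    ∑[ b < m ] ∑[ t < K ] (G (b * K + t) (b * K + t) +
      ∑[ s < K ] (G (b * K + t) (b * K + suc (t + s)) + G (b * K + suc (t + s)) (b * K + t)))
      ≡⟨ ∑-cong m (λ b _ → ∑-cong K (λ t _ → cong (G (b * K + t) (b * K + t) +_) (∑-cong K (λ s _ →
           cong (λ j → G (b * K + t) j + G j (b * K + t)) (+-suc-assoc (b * K) t s))))) ⟩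
    ∑[ b < m ] ∑[ t < K ] h (b * K + t)
      ≡⟨ sym (∑-* m K h) ⟩
    ∑[ i < m * K ] h i ∎
    where
    h = λ i → G i i + ∑[ s < K ] (G i (i + suc s) + G (i + suc s) i)
    +-suc-assoc : ∀ a t s → a + suc (t + s) ≡ a + t + suc s
    +-suc-assoc = solve-∀

  rowDot : ℕ → (ℕ → ℕ → ℕ) → ℕ → ℕ → ℕ
  rowDot P g i j = ∑[ l < P ] (g i l * g j l)

  rowDot-sym : ∀ P g i j → rowDot P g i j ≡ rowDot P g j i
  rowDot-sym P g i j = ∑-cong P (λ l _ → *-comm (g i l) (g j l))

  ∑-square≤blocks : ∀ P m K (g : ℕ → ℕ → ℕ) →
    ∑[ l < P ] (∑[ i < m * K ] g i l * ∑[ i < m * K ] g i l) ≤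
    m * ∑[ b < m ] ∑[ t < K ] ∑[ t′ < K ] rowDot P g (b * K + t) (b * K + t′)
  ∑-square≤blocks P m K g = begin
    ∑[ l < P ] (∑[ i < m * K ] g i l * ∑[ i < m * K ] g i l)
      ≡⟨ ∑-cong P (λ l _ → cong (λ z → z * z) (∑-* m K (λ i → g i l))) ⟩
    ∑[ l < P ] (∑[ b < m ] w b l * ∑[ b < m ] w b l)
      ≤⟨ ∑-mono P (λ l _ → cauchy-schwarz m (λ b → w b l)) ⟩
    ∑[ l < P ] (m * ∑[ b < m ] (w b l * w b l))
      ≡⟨ ∑-distribˡ-* P m _ ⟩
    m * ∑[ l < P ] ∑[ b < m ] (w b l * w b l)
      ≡⟨ cong (m *_) (trans (∑-comm P m _) (∑-cong m (λ b _ → block b))) ⟩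
    m * ∑[ b < m ] ∑[ t < K ] ∑[ t′ < K ] rowDot P g (b * K + t) (b * K + t′) ∎
    where
    w = λ b l → ∑[ t < K ] g (b * K + t) l
    block : ∀ b → ∑[ l < P ] (w b l * w b l) ≡ ∑[ t < K ] ∑[ t′ < K ] rowDot P g (b * K + t) (b * K + t′)
    block b = begin-equality
      ∑[ l < P ] (w b l * w b l)
        ≡⟨ ∑-cong P (λ l _ → ∑*∑ K K _ _) ⟩
      ∑[ l < P ] ∑[ t < K ] ∑[ t′ < K ] (g (b * K + t) l * g (b * K + t′) l)
        ≡⟨ ∑-comm P K _ ⟩
      ∑[ t < K ] ∑[ l < P ] ∑[ t′ < K ] (g (b * K + t) l * g (b * K + t′) l)
        ≡⟨ ∑-cong K (λ t _ → ∑-comm P K _) ⟩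
      ∑[ t < K ] ∑[ t′ < K ] rowDot P g (b * K + t) (b * K + t′) ∎

  ∑-square≤band : ∀ P m K (g : ℕ → ℕ → ℕ) →
    ∑[ l < P ] (∑[ i < m * K ] g i l * ∑[ i < m * K ] g i l) ≤
    m * ∑[ i < m * K ] (rowDot P g i i + 2 * ∑[ s < K ] rowDot P g i (i + suc s))
  ∑-square≤band P m K g = ≤-trans (∑-square≤blocks P m K g) (*-monoʳ-≤ m (≤-trans (blocks≤band m K G)
    (≤-reflexive (∑-cong (m * K) (λ i _ → cong (G i i +_) (symmetric i))))))
    where
    G = rowDot P g
    symmetric : ∀ i → ∑[ s < K ] (G i (i + suc s) + G (i + suc s) i) ≡ 2 * ∑[ s < K ] G i (i + suc s)
    symmetric i = begin-equality
      ∑[ s < K ] (G i (i + suc s) + G (i + suc s) i)  ≡⟨ ∑-cong K (λ s _ → cong (G i (i + suc s) +_) (rowDot-sym P g _ i)) ⟩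
      ∑[ s < K ] (G i (i + suc s) + G i (i + suc s))  ≡⟨ ∑-distrib-+ K _ _ ⟩
      S + S                                           ≡⟨ cong (S +_) (sym (+-identityʳ S)) ⟩
      2 * S                                           ∎
      where S = ∑[ s < K ] G i (i + suc s)

module ModularArithmetic where

  open import Data.Nat as ℕ using (ℕ; zero; suc; NonZero; _!; _%_; _/_; _≟_)
  import Data.Nat.Properties as ℕ
  open import Data.Nat.DivMod using (m≡m%n+[m/n]*n; m%n<n)
  import Data.Nat.Divisibility as ℕ
  open import Data.Nat.Primality using (Prime; euclidsLemma; prime⇒nonTrivial)
  open import Data.Integer using (+_; _+_; _-_; _*_; ∣_∣)
  open import Data.Integer.Properties
    using (pos-+; pos-*; +-injective; [+m]-[+n]≡m⊖n; ∣m⊝n∣≤m⊔n; ∣i∣≡0⇒i≡0; i-j≡0⇒i≡j; abs-*)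
  open import Data.Integer.Divisibility.Signed using (_∣_; divides; ∣⇒∣ᵤ; ∣ᵤ⇒∣; ∣m∣n⇒∣m-n)
  open import Data.Integer.Tactic.RingSolver using (solve-∀)
  open import Data.Sum using (_⊎_; inj₁; inj₂)
  open import Function using (_∘_)
  open import Relation.Nullary.Negation using (contradiction)
  open import Relation.Binary.PropositionalEquality
  open FiniteSums using (δ; 𝟙-mono)

  ∣∧<⇒≡0 : ∀ {p n} → p ℕ.∣ n → n ℕ.< p → n ≡ 0
  ∣∧<⇒≡0 {n = zero}  _   _   = refl
  ∣∧<⇒≡0 {n = suc n} p∣n n<p = contradiction (ℕ.∣⇒≤ p∣n) (ℕ.<⇒≱ n<p)

  <∧∣-⇒≡ : ∀ {p x y} → x ℕ.< p → y ℕ.< p → + p ∣ + x - + y → x ≡ y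
  <∧∣-⇒≡ {p} {x} {y} x<p y<p p∣x-y = +-injective (i-j≡0⇒i≡j (+ x) (+ y) (∣i∣≡0⇒i≡0 (∣∧<⇒≡0 (∣⇒∣ᵤ p∣x-y) ∣x-y∣<p)))
    where
    ∣x-y∣<p : ∣ + x - + y ∣ ℕ.< p
    ∣x-y∣<p = subst (ℕ._< p) (cong ∣_∣ (sym ([+m]-[+n]≡m⊖n x y))) (ℕ.≤-<-trans (∣m⊝n∣≤m⊔n x y) (ℕ.⊔-pres-<m x<p y<p))

  module _ (p : ℕ) .{{_ : NonZero p}} where

    +-%-/ : ∀ x → + x ≡ + (x % p) + + (x / p) * + p
    +-%-/ x = trans (cong +_ (m≡m%n+[m/n]*n x p)) (trans (pos-+ (x % p) _) (cong (λ z → + (x % p) + z) (pos-* (x / p) p)))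

    %≡%⇒∣- : ∀ x y → x % p ≡ y % p → + p ∣ + x - + y
    %≡%⇒∣- x y x≡y = divides (+ (x / p) - + (y / p)) (begin
      + x - + y                        ≡⟨ cong₂ _-_ (+-%-/ x) (+-%-/ y) ⟩
      + (x % p) + + (x / p) * + p - R  ≡⟨ cong (λ r → + r + + (x / p) * + p - R) x≡y ⟩
      + (y % p) + + (x / p) * + p - R  ≡⟨ cancel (+ (y % p)) (+ (x / p)) (+ (y / p)) (+ p) ⟩
      (+ (x / p) - + (y / p)) * + p    ∎)
      where
      open ≡-Reasoning
      R = + (y % p) + + (y / p) * + p
      cancel : ∀ r a b q → r + a * q - (r + b * q) ≡ (a - b) * q
      cancel = solve-∀

    ∣-⇒%≡% : ∀ x y → + p ∣ + x - + y → x % p ≡ y % p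
    ∣-⇒%≡% x y p∣x-y = <∧∣-⇒≡ (m%n<n x p) (m%n<n y p)
      (subst (+ p ∣_) (remainders (+ (x % p)) (+ (y % p)) (+ (x / p)) (+ (y / p)) (+ p))
        (∣m∣n⇒∣m-n (subst (+ p ∣_) (cong₂ _-_ (+-%-/ x) (+-%-/ y)) p∣x-y) (divides (+ (x / p) - + (y / p)) refl)))
      where
      remainders : ∀ r s a b q → r + a * q - (s + b * q) - (a - b) * q ≡ r - s
      remainders = solve-∀

  module _ {p : ℕ} (p-prime : Prime p) where

    euclidsLemmaℤ : ∀ i j → + p ∣ i * j → (+ p ∣ i) ⊎ (+ p ∣ j)
    euclidsLemmaℤ i j p∣ij with euclidsLemma ∣ i ∣ ∣ j ∣ p-prime (subst (p ℕ.∣_) (abs-* i j) (∣⇒∣ᵤ p∣ij))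
    ... | inj₁ p∣i = inj₁ (∣ᵤ⇒∣ p∣i)
    ... | inj₂ p∣j = inj₂ (∣ᵤ⇒∣ p∣j)

    ∣*-cancelˡ : ∀ {a} i → p ℕ.∤ a → + p ∣ + a * i → + p ∣ i
    ∣*-cancelˡ {a} i p∤a p∣ai with euclidsLemmaℤ (+ a) i p∣ai
    ... | inj₁ p∣a = contradiction (∣⇒∣ᵤ p∣a) p∤a
    ... | inj₂ p∣i = p∣i

    ∤*∤⇒∤* : ∀ {m n} → p ℕ.∤ m → p ℕ.∤ n → p ℕ.∤ m ℕ.* n
    ∤*∤⇒∤* {m} {n} p∤m p∤n p∣mn with euclidsLemma m n p-prime p∣mn
    ... | inj₁ p∣m = p∤m p∣m
    ... | inj₂ p∣n = p∤n p∣n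

    ∤! : ∀ {n} → n ℕ.< p → p ℕ.∤ n !
    ∤! {zero}  _   p∣1 = ℕ.<-irrefl (sym (ℕ.∣1⇒≡1 p∣1)) (ℕ.nonTrivial⇒n>1 p {{prime⇒nonTrivial p-prime}})
    ∤! {suc n} n<p     = ∤*∤⇒∤* (ℕ.<⇒≱ n<p ∘ ℕ.∣⇒≤) (∤! (ℕ.<-trans (ℕ.n<1+n n) n<p))

    module _ .{{_ : NonZero p}} where

      δ-*-cancelˡ : ∀ {a} x y → p ℕ.∤ a → δ ((a ℕ.* x) % p) ((a ℕ.* y) % p) ℕ.≤ δ (x % p) (y % p)
      δ-*-cancelˡ {a} x y p∤a = 𝟙-mono ((a ℕ.* x) % p ≟ (a ℕ.* y) % p) (x % p ≟ y % p) (λ ax≡ay →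
        ∣-⇒%≡% p x y (∣*-cancelˡ (+ x - + y) p∤a
          (subst (+ p ∣_) (trans (cong₂ _-_ (pos-* a x) (pos-* a y)) (factor (+ a) (+ x) (+ y))) (%≡%⇒∣- p _ _ ax≡ay))))
        where
        factor : ∀ a b c → a * b - a * c ≡ a * (b - c)
        factor = solve-∀

module PolynomialRoots where

  open import Data.Nat as ℕ using (ℕ; zero; suc; NonZero; _!; _%_; z≤n; s≤s)
  import Data.Nat.Properties as ℕ
  import Data.Nat.Divisibility as ℕ
  open import Data.Nat.Primality using (Prime)
  open import Data.Integer using (ℤ; +_; 0ℤ; 1ℤ; _+_; _-_; _*_; -_)
  open import Data.Integer.Properties using (+-identityʳ; *-identityʳ; *-zeroʳ; +-inverseʳ; *-distribˡ-+; pos-*; pos-+)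
  open import Data.Integer.Divisibility.Signed using (_∣_; ∣m∣n⇒∣m-n; ∣m⇒∣-m)
  open import Data.Integer.Tactic.RingSolver using (solve-∀)
  open import Data.Product using (∃-syntax; _×_; _,_)
  open import Data.Sum using (inj₁; inj₂)
  open import Function using (_∘_)
  open import Relation.Nullary using (¬_; yes; no)
  open import Relation.Nullary.Negation using (contradiction)
  open import Relation.Unary using (Decidable)
  open import Relation.Binary.PropositionalEquality
  open FiniteSums using (𝟙; ∑)
  open ModularArithmetic using (euclidsLemmaℤ; ∣*-cancelˡ; %≡%⇒∣-)

  -- Poly k c f: f is a polynomial function of degree ≤ k with coefficient c at z^k,
  -- characterised through the factor theorem instead of by a list of coefficients.
  Poly : ℕ → ℤ → (ℤ → ℤ) → Set
  Poly zero    c f = ∀ x → f x ≡ c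
  Poly (suc k) c f = ∀ r → ∃[ g ] Poly k c g × (∀ x → f x - f r ≡ (x - r) * g x)

  Poly-+ : ∀ k {c d f g} → Poly k c f → Poly k d g → Poly k (c + d) (λ x → f x + g x)
  Poly-+ zero    pf pg x = cong₂ _+_ (pf x) (pg x)
  Poly-+ (suc k) {f = f} {g} pf pg r with pf r | pg r
  ... | f′ , pf′ , ef | g′ , pg′ , eg = (λ x → f′ x + g′ x) , Poly-+ k pf′ pg′ , λ x →
    trans (regroup (f x) (g x) (f r) (g r)) (trans (cong₂ _+_ (ef x) (eg x)) (sym (*-distribˡ-+ (x - r) (f′ x) (g′ x))))
    where
    regroup : ∀ a b c d → a + b - (c + d) ≡ (a - c) + (b - d)
    regroup = solve-∀

  Poly-*ˡ : ∀ k {c f} s → Poly k c f → Poly k (s * c) (λ x → s * f x)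
  Poly-*ˡ zero    s pf x = cong (s *_) (pf x)
  Poly-*ˡ (suc k) {f = f} s pf r with pf r
  ... | g , pg , e = (λ x → s * g x) , Poly-*ˡ k s pg , λ x →
    trans (factor s (f x) (f r)) (trans (cong (s *_) (e x)) (swap s (x - r) (g x)))
    where
    factor : ∀ s a b → s * a - s * b ≡ s * (a - b)
    factor = solve-∀
    swap : ∀ s a b → s * (a * b) ≡ a * (s * b)
    swap = solve-∀

  Poly-raise : ∀ k {c f} → Poly k c f → Poly (suc k) 0ℤ f
  Poly-raise zero    {c} {f} pf r = (λ _ → 0ℤ) , (λ _ → refl) , λ x →
    trans (cong₂ _-_ (pf x) (pf r)) (trans (+-inverseʳ c) (sym (*-zeroʳ (x - r))))
  Poly-raise (suc k) pf r with pf r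
  ... | g , pg , e = g , Poly-raise k pg , e

  Poly-+const : ∀ k {c f} d → Poly (suc k) c f → Poly (suc k) c (λ x → f x + d)
  Poly-+const k {f = f} d pf r with pf r
  ... | g , pg , e = g , pg , λ x → trans (cancel (f x) (f r) d) (e x)
    where
    cancel : ∀ a b d → a + d - (b + d) ≡ a - b
    cancel = solve-∀

  Poly-*linear : ∀ k {c f} a → Poly k c f → Poly (suc k) c (λ x → (x + a) * f x)
  Poly-*linear zero    {c} {f} a pf r = f , pf , λ x →
    trans (cong₂ (λ u v → (x + a) * u - (r + a) * v) (pf x) (pf r)) (trans (factor x r a c) (cong ((x - r) *_) (sym (pf x))))
    where
    factor : ∀ x r a c → (x + a) * c - (r + a) * c ≡ (x - r) * c
    factor = solve-∀
  Poly-*linear (suc k) {c} {f} a pf r with pf r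
  ... | g , pg , e = quotient , subst (λ c′ → Poly (suc k) c′ quotient) (+-identityʳ c) poly-quotient , λ x →
    trans (split x r a (f x) (f r)) (trans (cong (λ z → (x - r) * f x + (r + a) * z) (e x)) (merge x r a (f x) (g x)))
    where
    quotient : ℤ → ℤ
    quotient x = f x + (r + a) * g x
    poly-quotient : Poly (suc k) (c + 0ℤ) quotient
    poly-quotient = Poly-+ (suc k) {f = f} {g = λ x → (r + a) * g x} pf
                      (Poly-raise k {f = λ x → (r + a) * g x} (Poly-*ˡ k {f = g} (r + a) pg))
    split : ∀ x r a u v → (x + a) * u - (r + a) * v ≡ (x - r) * u + (r + a) * (u - v)
    split = solve-∀
    merge : ∀ x r a u w → (x - r) * u + (r + a) * ((x - r) * w) ≡ (x - r) * (u + (r + a) * w)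
    merge = solve-∀

  rising : ℤ → ℕ → ℤ
  rising x zero    = 1ℤ
  rising x (suc d) = (x + + suc d) * rising x d

  Poly-rising : ∀ d → Poly d 1ℤ (λ x → rising x d)
  Poly-rising zero    _ = refl
  Poly-rising (suc d) = Poly-*linear d {f = λ x → rising x d} (+ suc d) (Poly-rising d)

  +[n+d]!≡+n!*rising : ∀ n d → + ((n ℕ.+ d) !) ≡ + (n !) * rising (+ n) d
  +[n+d]!≡+n!*rising n zero    = trans (cong (λ m → + (m !)) (ℕ.+-identityʳ n)) (sym (*-identityʳ _))
  +[n+d]!≡+n!*rising n (suc d) = begin
    + ((n ℕ.+ suc d) !)                            ≡⟨ cong (λ m → + (m !)) (ℕ.+-suc n d) ⟩
    + (suc (n ℕ.+ d) ℕ.* (n ℕ.+ d) !)              ≡⟨ pos-* (suc (n ℕ.+ d)) _ ⟩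
    + suc (n ℕ.+ d) * + ((n ℕ.+ d) !)              ≡⟨ cong₂ _*_ (trans (cong +_ (sym (ℕ.+-suc n d))) (pos-+ n (suc d)))
                                                                (+[n+d]!≡+n!*rising n d) ⟩
    (+ n + + suc d) * (+ (n !) * rising (+ n) d)   ≡⟨ swap (+ n + + suc d) (+ (n !)) (rising (+ n) d) ⟩
    + (n !) * ((+ n + + suc d) * rising (+ n) d)   ∎
    where
    open ≡-Reasoning
    swap : ∀ a b c → a * (b * c) ≡ b * (a * c)
    swap = solve-∀

  module _ {p} (p-prime : Prime p) where

    roots≤degree : ∀ M k {c f} → Poly k c f → ¬ (+ p ∣ c) →
                   (φ : ℕ → ℤ) → {R : ℕ → Set} (R? : Decidable R) →
                   (∀ i → R i → + p ∣ f (φ i)) → (∀ i j → R i → R j → + p ∣ φ i - φ j → i ≡ j) →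
                   ∑[ i < M ] 𝟙 (R? i) ℕ.≤ k
    roots≤degree zero    k poly p∤c φ R? root inj = z≤n
    roots≤degree (suc M) k poly p∤c φ R? root inj with R? 0
    ... | no _ = roots≤degree M k poly p∤c (φ ∘ suc) (R? ∘ suc) (root ∘ suc)
                   (λ i j Ri Rj → ℕ.suc-injective ∘ inj (suc i) (suc j) Ri Rj)
    roots≤degree (suc M) zero    poly p∤c φ R? root inj | yes R0 =
      contradiction (subst (+ p ∣_) (poly (φ 0)) (root 0 R0)) p∤c
    roots≤degree (suc M) (suc k) poly p∤c φ {R} R? root inj | yes R0 with poly (φ 0)
    ... | g , poly-g , factor = s≤s (roots≤degree M k poly-g p∤c (φ ∘ suc) (R? ∘ suc) root-g
                                       (λ i j Ri Rj → ℕ.suc-injective ∘ inj (suc i) (suc j) Ri Rj))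
      where
      root-g : ∀ i → R (suc i) → + p ∣ g (φ (suc i))
      root-g i Ri with euclidsLemmaℤ p-prime (φ (suc i) - φ 0) (g (φ (suc i)))
                         (subst (+ p ∣_) (factor (φ (suc i))) (∣m∣n⇒∣m-n (root (suc i) Ri) (root 0 R0)))
      ... | inj₁ p∣φi-φ0 = contradiction (inj (suc i) 0 Ri R0 p∣φi-φ0) λ ()
      ... | inj₂ p∣g     = p∣g

    module _ .{{_ : NonZero p}} where

      rising-root : ∀ {n x y} d → p ℕ.∤ n ! → (n ! ℕ.* x) % p ≡ ((n ℕ.+ d) ! ℕ.* y) % p →
                    + p ∣ + y * rising (+ n) d - + x
      rising-root {n} {x} {y} d p∤n! n!x≡[n+d]!y = subst (+ p ∣_) (negate (+ x) (+ y) (rising (+ n) d))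
        (∣m⇒∣-m (∣*-cancelˡ p-prime (+ x - rising (+ n) d * + y) p∤n! (subst (+ p ∣_) factor (%≡%⇒∣- p _ _ n!x≡[n+d]!y))))
        where
        open ≡-Reasoning
        negate : ∀ x y r → - (x - r * y) ≡ y * r - x
        negate = solve-∀
        factor : + (n ! ℕ.* x) - + ((n ℕ.+ d) ! ℕ.* y) ≡ + (n !) * (+ x - rising (+ n) d * + y)
        factor = begin
          + (n ! ℕ.* x) - + ((n ℕ.+ d) ! ℕ.* y)                ≡⟨ cong₂ _-_ (pos-* (n !) x) (pos-* ((n ℕ.+ d) !) y) ⟩
          + (n !) * + x - + ((n ℕ.+ d) !) * + y                ≡⟨ cong (λ z → + (n !) * + x - z * + y) (+[n+d]!≡+n!*rising n d) ⟩
          + (n !) * + x - + (n !) * rising (+ n) d * + y       ≡⟨ distrib (+ (n !)) (+ x) (rising (+ n) d) (+ y) ⟩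
          + (n !) * (+ x - rising (+ n) d * + y)               ∎
          where
          distrib : ∀ a x r y → a * x - a * r * y ≡ a * (x - r * y)
          distrib = solve-∀

module Powers where

  open import Data.Nat
  open import Data.Nat.Properties
  open import Data.Nat.DivMod using (m≡m%n+[m/n]*n; m%n<n; m/n*n≤m)
  open import Data.Nat.Tactic.RingSolver using (solve-∀)
  open import Data.Product using (∃-syntax; _×_; _,_)
  open import Data.Sum using (inj₁; inj₂)
  open import Relation.Nullary using (yes; no)
  open import Relation.Binary.PropositionalEquality
  open ≤-Reasoning

  [m*n]^k≡m^k*n^k : ∀ m n k → (m * n) ^ k ≡ m ^ k * n ^ k
  [m*n]^k≡m^k*n^k m n zero    = refl
  [m*n]^k≡m^k*n^k m n (suc k) = trans (cong (m * n *_) ([m*n]^k≡m^k*n^k m n k)) (interchange m n (m ^ k) (n ^ k))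
    where
    interchange : ∀ a b c d → a * b * (c * d) ≡ a * c * (b * d)
    interchange = solve-∀

  m^[2k]≡m^k*m^k : ∀ m k → m ^ (2 * k) ≡ m ^ k * m ^ k
  m^[2k]≡m^k*m^k m k = trans (^-distribˡ-+-* m k (k + 0)) (cong (λ j → m ^ k * m ^ j) (+-identityʳ k))

  [m+n]^k≤2^k*n^k : ∀ {m n} k → m ≤ n → (m + n) ^ k ≤ 2 ^ k * n ^ k
  [m+n]^k≤2^k*n^k {m} {n} k m≤n = begin
    (m + n) ^ k    ≤⟨ ^-monoˡ-≤ k (+-monoˡ-≤ n m≤n) ⟩
    (n + n) ^ k    ≡⟨ cong (λ j → (n + j) ^ k) (sym (+-identityʳ n)) ⟩
    (2 * n) ^ k    ≡⟨ [m*n]^k≡m^k*n^k 2 n k ⟩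
    2 ^ k * n ^ k  ∎

  [m+n]^k≤2^k*[m^k+n^k] : ∀ m n k → (m + n) ^ k ≤ 2 ^ k * (m ^ k + n ^ k)
  [m+n]^k≤2^k*[m^k+n^k] m n k with ≤-total m n
  ... | inj₁ m≤n = ≤-trans ([m+n]^k≤2^k*n^k k m≤n) (*-monoʳ-≤ (2 ^ k) (m≤n+m (n ^ k) (m ^ k)))
  ... | inj₂ n≤m = ≤-trans (subst (λ j → j ^ k ≤ 2 ^ k * m ^ k) (+-comm n m) ([m+n]^k≤2^k*n^k k n≤m))
                           (*-monoʳ-≤ (2 ^ k) (m≤m+n (m ^ k) (n ^ k)))

  ∃-root : ∀ R .{{_ : NonZero R}} N .{{_ : NonZero N}} → ∃[ K ] 1 ≤ K × K ^ R ≤ N × N < suc K ^ R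
  ∃-root R 1 = 1 , ≤-refl , ≤-reflexive (^-zeroˡ R) , subst (_< 2 ^ R) (^-zeroˡ R) (^-monoˡ-< R ≤-refl)
  ∃-root R (suc N@(suc _)) with ∃-root R N
  ... | K , 1≤K , K^R≤N , N<[1+K]^R with suc N <? suc K ^ R
  ...   | yes 1+N<[1+K]^R = K , 1≤K , m≤n⇒m≤1+n K^R≤N , 1+N<[1+K]^R
  ...   | no  1+N≮[1+K]^R = suc K , s≤s z≤n , ≤-reflexive (sym 1+N≡[1+K]^R) ,
                            subst (_< suc (suc K) ^ R) (sym 1+N≡[1+K]^R) (^-monoˡ-< R (n<1+n (suc K)))
    where
    1+N≡[1+K]^R : suc N ≡ suc K ^ R
    1+N≡[1+K]^R = ≤-antisym N<[1+K]^R (≮⇒≥ 1+N≮[1+K]^R)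

  ∃-cover : ∀ K N .{{_ : NonZero K}} → K ≤ N → ∃[ m ] N ≤ m * K × m * K ≤ 2 * N
  ∃-cover K N K≤N = suc (N / K) , N≤[1+N/K]*K , [1+N/K]*K≤2N
    where
    N≤[1+N/K]*K : N ≤ suc (N / K) * K
    N≤[1+N/K]*K = begin
      N                    ≡⟨ m≡m%n+[m/n]*n N K ⟩
      N % K + N / K * K    ≤⟨ +-monoˡ-≤ (N / K * K) (<⇒≤ (m%n<n N K)) ⟩
      K + N / K * K        ∎
    [1+N/K]*K≤2N : suc (N / K) * K ≤ 2 * N
    [1+N/K]*K≤2N = begin
      K + N / K * K        ≤⟨ +-mono-≤ K≤N (m/n*n≤m N K) ⟩
      N + N                ≡⟨ cong (N +_) (sym (+-identityʳ N)) ⟩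
      2 * N                ∎

  ∃-scale : ∀ M .{{_ : NonZero M}} N .{{_ : NonZero N}} → ∃[ K ] ∃[ m ]
            N ≤ m * K × m * K ≤ 2 * N × K ^ M * K ^ M ≤ N × N ≤ 2 ^ M * 2 ^ M * (K ^ M * K ^ M)
  ∃-scale M N with ∃-root (2 * M) {{m*n≢0 2 M}} N
  ... | K , 1≤K , K^2M≤N , N<[1+K]^2M with ∃-cover K N {{>-nonZero 1≤K}} K≤N
    where
    K≤N : K ≤ N
    K≤N = begin
      K            ≡⟨ sym (*-identityʳ K) ⟩
      K ^ 1        ≤⟨ ^-monoʳ-≤ K {{>-nonZero 1≤K}} (>-nonZero⁻¹ (2 * M) {{m*n≢0 2 M}}) ⟩
      K ^ (2 * M)  ≤⟨ K^2M≤N ⟩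
      N            ∎
  ... | m , N≤mK , mK≤2N = K , m , N≤mK , mK≤2N , subst (_≤ N) (m^[2k]≡m^k*m^k K M) K^2M≤N , N≤[2K]^2M
    where
    N≤[2K]^2M : N ≤ 2 ^ M * 2 ^ M * (K ^ M * K ^ M)
    N≤[2K]^2M = begin
      N                                    ≤⟨ <⇒≤ N<[1+K]^2M ⟩
      suc K ^ (2 * M)                      ≤⟨ ^-monoˡ-≤ (2 * M) (+-monoˡ-≤ K 1≤K) ⟩
      (K + K) ^ (2 * M)                    ≡⟨ cong (λ j → (K + j) ^ (2 * M)) (sym (+-identityʳ K)) ⟩
      (2 * K) ^ (2 * M)                    ≡⟨ [m*n]^k≡m^k*n^k 2 K (2 * M) ⟩
      2 ^ (2 * M) * K ^ (2 * M)            ≡⟨ cong₂ _*_ (m^[2k]≡m^k*m^k 2 M) (m^[2k]≡m^k*m^k K M) ⟩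
      2 ^ M * 2 ^ M * (K ^ M * K ^ M)      ∎

  step-constant : ℕ → ℕ → ℕ
  step-constant M C = t * t * (t * t) * (t * t) * ((C + t) * (C + t))
    where t = 2 ^ M

  power-bound : ∀ M C N u J J′ K →
    J ^ M * N ^ M ≤ C * u ^ (2 * M) * N → K ^ M * K ^ M ≤ N → J′ * K ≤ 2 * N * (N * J + 2 * (K * K) * (u * u)) →
    J′ ^ M * K ^ M ≤ 2 ^ M * 2 ^ M * (C + 2 ^ M) * N ^ M * (u ^ M * u ^ M) * N
  power-bound M C N u J J′ K bound k²≤N J′K≤2NB = begin
    J′ ^ M * K ^ M                                      ≡⟨ sym ([m*n]^k≡m^k*n^k J′ K M) ⟩
    (J′ * K) ^ M                                        ≤⟨ ^-monoˡ-≤ M J′K≤2NB ⟩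
    (2 * N * B) ^ M                                     ≡⟨ trans ([m*n]^k≡m^k*n^k (2 * N) B M) (cong (_* B ^ M) ([m*n]^k≡m^k*n^k 2 N M)) ⟩
    t * ν * B ^ M                                       ≤⟨ *-monoʳ-≤ (t * ν) B^M≤ ⟩
    t * ν * (t * (J ^ M * ν + t * (k * k) * (υ * υ)))   ≤⟨ *-monoʳ-≤ (t * ν) (*-monoʳ-≤ t (+-mono-≤
                                                             (≤-trans bound (≤-reflexive (cong (λ z → C * z * N) (m^[2k]≡m^k*m^k u M))))
                                                             (*-monoˡ-≤ (υ * υ) (*-monoʳ-≤ t k²≤N)))) ⟩
    t * ν * (t * (C * (υ * υ) * N + t * N * (υ * υ)))   ≡⟨ collect t ν C υ N ⟩
    t * t * (C + t) * ν * (υ * υ) * N                   ∎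
    where
    t = 2 ^ M
    ν = N ^ M
    υ = u ^ M
    k = K ^ M
    B = N * J + 2 * (K * K) * (u * u)
    collect : ∀ t ν C υ N → t * ν * (t * (C * (υ * υ) * N + t * N * (υ * υ))) ≡ t * t * (C + t) * ν * (υ * υ) * N
    collect = solve-∀
    B^M≤ : B ^ M ≤ t * (J ^ M * ν + t * (k * k) * (υ * υ))
    B^M≤ = begin
      B ^ M                                                 ≤⟨ [m+n]^k≤2^k*[m^k+n^k] (N * J) _ M ⟩
      t * ((N * J) ^ M + (2 * (K * K) * (u * u)) ^ M)       ≡⟨ cong (t *_) (cong₂ _+_
        (trans ([m*n]^k≡m^k*n^k N J M) (*-comm ν _))
        (trans ([m*n]^k≡m^k*n^k (2 * (K * K)) (u * u) M) (cong₂ _*_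
          (trans ([m*n]^k≡m^k*n^k 2 (K * K) M) (cong (t *_) ([m*n]^k≡m^k*n^k K K M))) ([m*n]^k≡m^k*n^k u u M)))) ⟩
      t * (J ^ M * ν + t * (k * k) * (υ * υ))               ∎

  -- K is chosen with K^(2M) ≈ N, which balances the two terms of the recursion.
  bound-step : ∀ M C N u J J′ .{{_ : NonZero M}} .{{_ : NonZero N}} →
    J ^ M * N ^ M ≤ C * u ^ (2 * M) * N →
    (∀ m K → N ≤ m * K → J′ ≤ m * (N * J + 2 * (K * K) * (u * u))) →
    J′ ^ (2 * M) * N ^ (2 * M) ≤ step-constant M C * (N * u) ^ (2 * (2 * M)) * N
  bound-step M C N u J J′ bound recurrence with ∃-scale M N
  ... | K , m , N≤mK , mK≤2N , k²≤N , N≤t²k² = begin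
    J′ ^ (2 * M) * N ^ (2 * M)           ≡⟨ cong₂ _*_ (m^[2k]≡m^k*m^k J′ M) (m^[2k]≡m^k*m^k N M) ⟩
    e * e * (ν * ν)                      ≤⟨ *-monoˡ-≤ (ν * ν) (*-cancelˡ-≤ N Ne²≤NW) ⟩
    W * (ν * ν)                          ≡⟨ regroup (step-constant M C) ν υ N ⟩
    step-constant M C * (ν * ν * (υ * υ) * (ν * ν * (υ * υ))) * N
                                         ≡⟨ cong (λ z → step-constant M C * z * N) (sym [Nu]^4M) ⟩
    step-constant M C * (N * u) ^ (2 * (2 * M)) * N ∎
    where
    t = 2 ^ M
    ν = N ^ M
    υ = u ^ M
    k = K ^ M
    e = J′ ^ M
    Z = t * t * (C + t) * ν * (υ * υ) * N
    W = step-constant M C * (ν * ν * (υ * υ) * (υ * υ)) * N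
    regroup : ∀ D ν υ N → D * (ν * ν * (υ * υ) * (υ * υ)) * N * (ν * ν) ≡ D * (ν * ν * (υ * υ) * (ν * ν * (υ * υ))) * N
    regroup = solve-∀
    [Nu]^4M : (N * u) ^ (2 * (2 * M)) ≡ ν * ν * (υ * υ) * (ν * ν * (υ * υ))
    [Nu]^4M = trans (m^[2k]≡m^k*m^k (N * u) (2 * M)) (cong (λ z → z * z)
      (trans ([m*n]^k≡m^k*n^k N u (2 * M)) (cong₂ _*_ (m^[2k]≡m^k*m^k N M) (m^[2k]≡m^k*m^k u M))))
    J′K≤2NB : J′ * K ≤ 2 * N * (N * J + 2 * (K * K) * (u * u))
    J′K≤2NB = begin
      J′ * K                                         ≤⟨ *-monoˡ-≤ K (recurrence m K N≤mK) ⟩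
      m * (N * J + 2 * (K * K) * (u * u)) * K        ≡⟨ *-right-comm m _ K ⟩
      m * K * (N * J + 2 * (K * K) * (u * u))        ≤⟨ *-monoˡ-≤ _ mK≤2N ⟩
      2 * N * (N * J + 2 * (K * K) * (u * u))        ∎
      where
      *-right-comm : ∀ a b c → a * b * c ≡ a * c * b
      *-right-comm = solve-∀
    Ne²≤NW : N * (e * e) ≤ N * W
    Ne²≤NW = begin
      N * (e * e)                  ≤⟨ *-monoˡ-≤ (e * e) N≤t²k² ⟩
      t * t * (k * k) * (e * e)    ≡⟨ interchange (t * t) k e ⟩
      t * t * (e * k * (e * k))    ≤⟨ *-monoʳ-≤ (t * t) (*-mono-≤ ek≤Z ek≤Z) ⟩
      t * t * (Z * Z)              ≡⟨ expand t C ν υ N ⟩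
      N * W                        ∎
      where
      ek≤Z = power-bound M C N u J J′ K bound k²≤N J′K≤2NB
      interchange : ∀ a k e → a * (k * k) * (e * e) ≡ a * (e * k * (e * k))
      interchange = solve-∀
      expand : ∀ t C ν υ N → t * t * ((t * t * (C + t) * ν * (υ * υ) * N) * (t * t * (C + t) * ν * (υ * υ) * N)) ≡
                              N * ((t * t * (t * t) * (t * t) * ((C + t) * (C + t))) * (ν * ν * (υ * υ) * (υ * υ)) * N)
      expand = solve-∀

  0^n≡0 : ∀ n .{{_ : NonZero n}} → 0 ^ n ≡ 0
  0^n≡0 (suc n) = refl

  [n^[1+ℓ]]^[2M]*n≡n^[[2[1+ℓ]∸1]M+1]*n^M : ∀ n ℓ M → (n ^ suc ℓ) ^ (2 * M) * n ≡ n ^ ((2 * suc ℓ ∸ 1) * M + 1) * n ^ M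
  [n^[1+ℓ]]^[2M]*n≡n^[[2[1+ℓ]∸1]M+1]*n^M n ℓ M = begin-equality
    (n ^ suc ℓ) ^ (2 * M) * n                  ≡⟨ cong₂ _*_ (^-*-assoc n (suc ℓ) (2 * M)) (sym (*-identityʳ n)) ⟩
    n ^ (suc ℓ * (2 * M)) * n ^ 1              ≡⟨ sym (^-distribˡ-+-* n (suc ℓ * (2 * M)) 1) ⟩
    n ^ (suc ℓ * (2 * M) + 1)                  ≡⟨ cong (n ^_) (exponent ℓ M) ⟩
    n ^ (suc (2 * ℓ) * M + 1 + M)              ≡⟨ cong (λ e → n ^ (e * M + 1 + M)) (cong (_∸ 1) (sym (*-suc 2 ℓ))) ⟩
    n ^ ((2 * suc ℓ ∸ 1) * M + 1 + M)          ≡⟨ ^-distribˡ-+-* n ((2 * suc ℓ ∸ 1) * M + 1) M ⟩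
    n ^ ((2 * suc ℓ ∸ 1) * M + 1) * n ^ M      ∎
    where
    exponent : ∀ ℓ M → suc ℓ * (2 * M) + 1 ≡ suc (2 * ℓ) * M + 1 + M
    exponent = solve-∀

open import Defs
open import Data.Nat
open import Data.Nat.Properties
open import Data.Nat.Primality using (Prime)
open import Data.Nat.Tactic.RingSolver using (solve-∀)
open import Data.Product using (∃-syntax; _,_)
open import Relation.Binary.PropositionalEquality
open Powers using (bound-step; step-constant; 0^n≡0; [n^[1+ℓ]]^[2M]*n≡n^[[2[1+ℓ]∸1]M+1]*n^M)
open ≤-Reasoning

module Energy (p : ℕ) .{{_ : NonZero p}} (p-prime : Prime p) (H N : ℕ) (H+N<p : H + N < p) where

  open import Data.Nat.DivMod using (m%n<n)
  open import Data.Nat.Divisibility using (_∣_; _∤_)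
  open import Data.List using (List; _∷_; map; upTo; cartesianProduct)
  open import Data.Product using (_×_)
  open import Function using (_∘_)
  open import Relation.Nullary using (¬_)
  open import Relation.Nullary.Decidable using (_×-dec_)
  open import Relation.Unary using (Decidable)
  import Data.Integer as ℤ
  import Data.Integer.Properties as ℤ
  import Data.Integer.Divisibility.Signed as ℤ
  open FiniteSums
  open ModularArithmetic using (<∧∣-⇒≡; ∤*∤⇒∤*; ∤!; δ-*-cancelˡ)
  open PolynomialRoots

  a : ℕ → ℕ
  a i = H + suc i

  a<p : ∀ {i} → i < N → a i < p
  a<p i<N = ≤-<-trans (+-monoʳ-≤ H i<N) H+N<p

  products : ℕ → List ℕ
  products ℓ = map prodFact (tuples ℓ (interval H N))

  ∑ᴾ-suc : ∀ ℓ f → ∑[ x ∈ products (suc ℓ) ] f x ≡ ∑[ i < N ] ∑[ x ∈ products ℓ ] f (a i ! * x)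
  ∑ᴾ-suc ℓ f = begin-equality
    ∑[ x ∈ products (suc ℓ) ] f x
      ≡⟨ ∑ᴸ-map prodFact (tuples (suc ℓ) (interval H N)) f ⟩
    ∑[ t ∈ tuples (suc ℓ) (interval H N) ] f (prodFact t)
      ≡⟨ ∑ᴸ-concatMap (λ n → map (n ∷_) (tuples ℓ (interval H N))) (interval H N) _ ⟩
    ∑[ n ∈ interval H N ] ∑[ t ∈ map (n ∷_) (tuples ℓ (interval H N)) ] f (prodFact t)
      ≡⟨ ∑ᴸ-cong (interval H N) (λ n →
           trans (∑ᴸ-map (n ∷_) T (f ∘ prodFact)) (sym (∑ᴸ-map prodFact T (λ x → f (n ! * x))))) ⟩
    ∑[ n ∈ interval H N ] ∑[ x ∈ products ℓ ] f (n ! * x)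
      ≡⟨ ∑ᴸ-map a (upTo N) _ ⟩
    ∑[ i ∈ upTo N ] ∑[ x ∈ products ℓ ] f (a i ! * x)
      ≡⟨ ∑ᴸ-applyUpTo (λ i → i) N _ ⟩
    ∑[ i < N ] ∑[ x ∈ products ℓ ] f (a i ! * x) ∎
    where T = tuples ℓ (interval H N)

  ∑ᴾ-mono : ∀ ℓ {f g : ℕ → ℕ} → (∀ x → p ∤ x → f x ≤ g x) → ∑ᴸ (products ℓ) f ≤ ∑ᴸ (products ℓ) g
  ∑ᴾ-mono zero    f≤g = +-monoˡ-≤ 0 (f≤g 1 (∤! p-prime (>-nonZero⁻¹ p)))
  ∑ᴾ-mono (suc ℓ) {f} {g} f≤g = begin
    ∑ᴸ (products (suc ℓ)) f                       ≡⟨ ∑ᴾ-suc ℓ f ⟩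
    ∑[ i < N ] ∑[ x ∈ products ℓ ] f (a i ! * x)  ≤⟨ ∑-mono N (λ i i<N → ∑ᴾ-mono ℓ (λ x p∤x →
                                                f≤g (a i ! * x) (∤*∤⇒∤* p-prime (∤! p-prime (a<p i<N)) p∤x))) ⟩
    ∑[ i < N ] ∑[ x ∈ products ℓ ] g (a i ! * x)  ≡⟨ sym (∑ᴾ-suc ℓ g) ⟩
    ∑ᴸ (products (suc ℓ)) g                       ∎

  ∑ᴾ-const : ∀ ℓ c → ∑[ x ∈ products ℓ ] c ≡ c * N ^ ℓ
  ∑ᴾ-const zero    c = trans (+-identityʳ c) (sym (*-identityʳ c))
  ∑ᴾ-const (suc ℓ) c = begin-equality
    ∑[ x ∈ products (suc ℓ) ] c       ≡⟨ ∑ᴾ-suc ℓ (λ _ → c) ⟩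
    ∑[ i < N ] ∑[ x ∈ products ℓ ] c  ≡⟨ ∑-cong N (λ _ _ → ∑ᴾ-const ℓ c) ⟩
    ∑[ i < N ] (c * N ^ ℓ)            ≡⟨ ∑-const N _ ⟩
    N * (c * N ^ ℓ)                   ≡⟨ *-left-comm N c _ ⟩
    c * N ^ suc ℓ                     ∎
    where
    *-left-comm : ∀ a b c → a * (b * c) ≡ b * (a * c)
    *-left-comm = solve-∀

  energy : ℕ → ℕ
  energy ℓ = ∑[ x ∈ products ℓ ] ∑[ y ∈ products ℓ ] δ (x % p) (y % p)

  I≡energy : ∀ ℓ → I ℓ p H N ≡ energy ℓ
  I≡energy ℓ = begin-equality
    I ℓ p H N
      ≡⟨ length-filter _ (cartesianProduct T T) ⟩
    ∑ᴸ (cartesianProduct T T) _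
      ≡⟨ ∑ᴸ-cartesianProduct T T _ ⟩
    ∑[ s ∈ T ] ∑[ t ∈ T ] δ (prodFact s % p) (prodFact t % p)
      ≡⟨ ∑ᴸ-cong T (λ s → sym (∑ᴸ-map prodFact T _)) ⟩
    ∑[ s ∈ T ] ∑[ y ∈ products ℓ ] δ (prodFact s % p) (y % p)
      ≡⟨ sym (∑ᴸ-map prodFact T _) ⟩
    energy ℓ ∎
    where T = tuples ℓ (interval H N)

  -- products 0 is the one-element list [ 1 ], the empty product.
  energy-zero : energy 0 ≡ 1
  energy-zero = cong (λ n → n + 0 + 0) (δ-refl (1 % p))

  multiplicity : ℕ → ℕ → ℕ → ℕ
  multiplicity ℓ i l = ∑[ x ∈ products ℓ ] δ ((a i ! * x) % p) l

  -- Vanishes for i ≥ N, so that the range of i can be padded up to a multiple of the block length.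
  multiplicity<N : ℕ → ℕ → ℕ → ℕ
  multiplicity<N ℓ i l = 𝟙 (i <? N) * multiplicity ℓ i l

  collisions : ℕ → ℕ → ℕ → ℕ
  collisions ℓ i j = ∑[ x ∈ products ℓ ] ∑[ y ∈ products ℓ ] δ ((a i ! * x) % p) ((a j ! * y) % p)

  energy-suc≡ : ∀ ℓ {M} → N ≤ M →
                energy (suc ℓ) ≡ ∑[ l < p ] (∑[ i < M ] multiplicity<N ℓ i l * ∑[ i < M ] multiplicity<N ℓ i l)
  energy-suc≡ ℓ {M} N≤M = begin-equality
    energy (suc ℓ)
      ≡⟨ sym (∑-mult*mult≡collisions p Xs Xs (_% p) (_% p) (λ x → m%n<n x p)) ⟩
    ∑[ l < p ] (∑[ x ∈ Xs ] δ (x % p) l * ∑[ x ∈ Xs ] δ (x % p) l)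
      ≡⟨ ∑-cong p (λ l _ → cong (λ z → z * z)
           (trans (∑ᴾ-suc ℓ (λ x → δ (x % p) l)) (∑-truncate (λ i → multiplicity ℓ i l) N≤M))) ⟩
    ∑[ l < p ] (∑[ i < M ] multiplicity<N ℓ i l * ∑[ i < M ] multiplicity<N ℓ i l) ∎
    where Xs = products (suc ℓ)

  rowDot-multiplicity<N : ∀ ℓ i j → rowDot p (multiplicity<N ℓ) i j ≡ 𝟙 (i <? N) * 𝟙 (j <? N) * collisions ℓ i j
  rowDot-multiplicity<N ℓ i j = begin-equality
    ∑[ l < p ] (𝟙 (i <? N) * multiplicity ℓ i l * (𝟙 (j <? N) * multiplicity ℓ j l))
      ≡⟨ ∑-cong p (λ l _ → interchange (𝟙 (i <? N)) (multiplicity ℓ i l) (𝟙 (j <? N)) (multiplicity ℓ j l)) ⟩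
    ∑[ l < p ] (𝟙 (i <? N) * 𝟙 (j <? N) * (multiplicity ℓ i l * multiplicity ℓ j l))
      ≡⟨ ∑-distribˡ-* p (𝟙 (i <? N) * 𝟙 (j <? N)) _ ⟩
    𝟙 (i <? N) * 𝟙 (j <? N) * ∑[ l < p ] (multiplicity ℓ i l * multiplicity ℓ j l)
      ≡⟨ cong (𝟙 (i <? N) * 𝟙 (j <? N) *_)
           (∑-mult*mult≡collisions p (products ℓ) (products ℓ) _ _ (λ x → m%n<n (a i ! * x) p)) ⟩
    𝟙 (i <? N) * 𝟙 (j <? N) * collisions ℓ i j ∎
    where
    interchange : ∀ a b c d → a * b * (c * d) ≡ a * c * (b * d)
    interchange = solve-∀

  diagonal≤ : ∀ ℓ M → ∑[ i < M ] rowDot p (multiplicity<N ℓ) i i ≤ N * energy ℓ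
  diagonal≤ ℓ M = begin
    ∑[ i < M ] rowDot p (multiplicity<N ℓ) i i
      ≡⟨ ∑-cong M (λ i _ → trans (rowDot-multiplicity<N ℓ i i) (cong (_* collisions ℓ i i) (𝟙*𝟙≡𝟙 (i <? N)))) ⟩
    ∑[ i < M ] (𝟙 (i <? N) * collisions ℓ i i)
      ≤⟨ ∑-mono M (λ i _ → 𝟙*-monoʳ (i <? N) (λ i<N →
           ∑ᴸ-mono (products ℓ) (λ x → ∑ᴸ-mono (products ℓ) (λ y → δ-*-cancelˡ p-prime x y (∤! p-prime (a<p i<N)))))) ⟩
    ∑[ i < M ] (𝟙 (i <? N) * energy ℓ)
      ≡⟨ ∑-distribʳ-* M (energy ℓ) _ ⟩
    ∑[ i < M ] 𝟙 (i <? N) * energy ℓ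
      ≤⟨ *-monoˡ-≤ (energy ℓ) (∑-𝟙-< M N) ⟩
    N * energy ℓ ∎

  shifted-collisions : ℕ → ℕ → ℕ → ℕ → ℕ
  shifted-collisions M s x y = ∑[ i < M ] (𝟙 (i + suc s <? N) * δ ((a i ! * x) % p) ((a (i + suc s) ! * y) % p))

  shifted-collisions≤ : ∀ {x y} s M → p ∤ y → shifted-collisions M s x y ≤ suc s
  shifted-collisions≤ {x} {y} s M p∤y = begin
    shifted-collisions M s x y
      ≡⟨ ∑-cong M (λ i _ → sym (𝟙-× (i + suc s <? N) ((a i ! * x) % p ≟ (a (i + suc s) ! * y) % p))) ⟩
    ∑[ i < M ] 𝟙 (R? i)
      ≤⟨ roots≤degree p-prime M (suc s) {f = target} poly p∤y·1 (λ i → ℤ.+ a i) {R} R? root distinct ⟩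
    suc s ∎
    where
    R : ℕ → Set
    R i = i + suc s < N × (a i ! * x) % p ≡ (a (i + suc s) ! * y) % p
    R? : Decidable R
    R? i = (i + suc s <? N) ×-dec ((a i ! * x) % p ≟ (a (i + suc s) ! * y) % p)
    target : ℤ.ℤ → ℤ.ℤ
    target z = ℤ.+ y ℤ.* rising z (suc s) ℤ.- ℤ.+ x
    poly : Poly (suc s) (ℤ.+ y ℤ.* ℤ.1ℤ) target
    poly = Poly-+const s {f = λ z → ℤ.+ y ℤ.* rising z (suc s)} (ℤ.- ℤ.+ x)
             (Poly-*ˡ (suc s) {f = λ z → rising z (suc s)} (ℤ.+ y) (Poly-rising (suc s)))
    p∤y·1 : ¬ (ℤ.+ p ℤ.∣ ℤ.+ y ℤ.* ℤ.1ℤ)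
    p∤y·1 p∣y·1 = p∤y (subst (p ∣_) (cong ℤ.∣_∣ (ℤ.*-identityʳ (ℤ.+ y))) (ℤ.∣⇒∣ᵤ p∣y·1))
    i<N : ∀ {i} → i + suc s < N → i < N
    i<N lt = ≤-<-trans (m≤m+n _ (suc s)) lt
    root : ∀ i → R i → ℤ.+ p ℤ.∣ target (ℤ.+ a i)
    root i (lt , a!x≡a!y) = rising-root p-prime {a i} {x} {y} (suc s) (∤! p-prime (a<p (i<N lt)))
      (trans a!x≡a!y (cong (λ n → (n ! * y) % p) (shift H i s)))
      where
      shift : ∀ H i s → H + suc (i + suc s) ≡ H + suc i + suc s
      shift = solve-∀
    distinct : ∀ i j → R i → R j → ℤ.+ p ℤ.∣ ℤ.+ a i ℤ.- ℤ.+ a j → i ≡ j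
    distinct i j (lti , _) (ltj , _) p∣ai-aj =
      suc-injective (+-cancelˡ-≡ H _ _ (<∧∣-⇒≡ (a<p (i<N lti)) (a<p (i<N ltj)) p∣ai-aj))

  band≤ : ∀ ℓ M K → ∑[ i < M ] ∑[ s < K ] rowDot p (multiplicity<N ℓ) i (i + suc s) ≤ K * K * (N ^ ℓ * N ^ ℓ)
  band≤ ℓ M K = begin
    ∑[ i < M ] ∑[ s < K ] rowDot p (multiplicity<N ℓ) i (i + suc s)
      ≤⟨ ∑-mono M (λ i _ → ∑-mono K (λ s _ → rowDot≤ i (i + suc s))) ⟩
    ∑[ i < M ] ∑[ s < K ] (𝟙 (i + suc s <? N) * collisions ℓ i (i + suc s))
      ≡⟨ ∑-cong M (λ i _ → ∑-cong K (λ s _ → distrib i s)) ⟩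
    ∑[ i < M ] ∑[ s < K ] ∑[ x ∈ Xs ] ∑[ y ∈ Xs ] F i s x y
      ≡⟨ reorder ⟩
    ∑[ x ∈ Xs ] ∑[ y ∈ Xs ] ∑[ s < K ] shifted-collisions M s x y
      ≤⟨ ∑ᴸ-mono Xs (λ x → ∑ᴾ-mono ℓ (λ y p∤y → ∑-mono K (λ s s<K → ≤-trans (shifted-collisions≤ s M p∤y) s<K))) ⟩
    ∑[ x ∈ Xs ] ∑[ y ∈ Xs ] ∑[ s < K ] K
      ≡⟨ ∑ᴸ-cong Xs (λ x → trans (∑ᴸ-cong Xs (λ y → ∑-const K K)) (∑ᴾ-const ℓ (K * K))) ⟩
    ∑[ x ∈ Xs ] (K * K * N ^ ℓ)
      ≡⟨ trans (∑ᴾ-const ℓ _) (*-assoc (K * K) _ _) ⟩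
    K * K * (N ^ ℓ * N ^ ℓ) ∎
    where
    Xs = products ℓ
    D = λ i s x y → δ ((a i ! * x) % p) ((a (i + suc s) ! * y) % p)
    F = λ i s x y → 𝟙 (i + suc s <? N) * D i s x y
    rowDot≤ : ∀ i j → rowDot p (multiplicity<N ℓ) i j ≤ 𝟙 (j <? N) * collisions ℓ i j
    rowDot≤ i j = begin
      rowDot p (multiplicity<N ℓ) i j               ≡⟨ rowDot-multiplicity<N ℓ i j ⟩
      𝟙 (i <? N) * 𝟙 (j <? N) * collisions ℓ i j   ≤⟨ *-monoˡ-≤ (collisions ℓ i j) (*-monoˡ-≤ (𝟙 (j <? N)) (𝟙≤1 (i <? N))) ⟩
      1 * 𝟙 (j <? N) * collisions ℓ i j            ≡⟨ cong (_* collisions ℓ i j) (*-identityˡ (𝟙 (j <? N))) ⟩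
      𝟙 (j <? N) * collisions ℓ i j                ∎
    distrib : ∀ i s → 𝟙 (i + suc s <? N) * collisions ℓ i (i + suc s) ≡ ∑[ x ∈ Xs ] ∑[ y ∈ Xs ] F i s x y
    distrib i s = trans (sym (∑ᴸ-distribˡ-* Xs (𝟙 (i + suc s <? N)) _))
      (∑ᴸ-cong Xs (λ x → sym (∑ᴸ-distribˡ-* Xs (𝟙 (i + suc s <? N)) (D i s x))))
    reorder : ∑[ i < M ] ∑[ s < K ] ∑[ x ∈ Xs ] ∑[ y ∈ Xs ] F i s x y ≡
              ∑[ x ∈ Xs ] ∑[ y ∈ Xs ] ∑[ s < K ] ∑[ i < M ] F i s x y
    reorder = begin-equality
      ∑[ i < M ] ∑[ s < K ] ∑[ x ∈ Xs ] ∑[ y ∈ Xs ] F i s x y  ≡⟨ ∑-comm M K _ ⟩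
      ∑[ s < K ] ∑[ i < M ] ∑[ x ∈ Xs ] ∑[ y ∈ Xs ] F i s x y  ≡⟨ ∑-cong K (λ s _ → ∑-∑ᴸ-comm M Xs _) ⟩
      ∑[ s < K ] ∑[ x ∈ Xs ] ∑[ i < M ] ∑[ y ∈ Xs ] F i s x y  ≡⟨ ∑-∑ᴸ-comm K Xs _ ⟩
      ∑[ x ∈ Xs ] ∑[ s < K ] ∑[ i < M ] ∑[ y ∈ Xs ] F i s x y  ≡⟨ ∑ᴸ-cong Xs (λ x → ∑-cong K (λ s _ → ∑-∑ᴸ-comm M Xs _)) ⟩
      ∑[ x ∈ Xs ] ∑[ s < K ] ∑[ y ∈ Xs ] ∑[ i < M ] F i s x y  ≡⟨ ∑ᴸ-cong Xs (λ x → ∑-∑ᴸ-comm K Xs _) ⟩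
      ∑[ x ∈ Xs ] ∑[ y ∈ Xs ] ∑[ s < K ] ∑[ i < M ] F i s x y  ∎

  energy-suc≤ : ∀ ℓ m K → N ≤ m * K → energy (suc ℓ) ≤ m * (N * energy ℓ + 2 * (K * K) * (N ^ ℓ * N ^ ℓ))
  energy-suc≤ ℓ m K N≤mK = begin
    energy (suc ℓ)
      ≡⟨ energy-suc≡ ℓ N≤mK ⟩
    ∑[ l < p ] (∑[ i < m * K ] multiplicity<N ℓ i l * ∑[ i < m * K ] multiplicity<N ℓ i l)
      ≤⟨ ∑-square≤band p m K (multiplicity<N ℓ) ⟩
    m * ∑[ i < m * K ] (G i i + 2 * ∑[ s < K ] G i (i + suc s))
      ≡⟨ cong (m *_) (trans (∑-distrib-+ (m * K) _ _) (cong (∑[ i < m * K ] G i i +_) (∑-distribˡ-* (m * K) 2 _))) ⟩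
    m * (∑[ i < m * K ] G i i + 2 * ∑[ i < m * K ] ∑[ s < K ] G i (i + suc s))
      ≤⟨ *-monoʳ-≤ m (+-mono-≤ (diagonal≤ ℓ (m * K)) (*-monoʳ-≤ 2 (band≤ ℓ (m * K) K))) ⟩
    m * (N * energy ℓ + 2 * (K * K * (N ^ ℓ * N ^ ℓ)))
      ≡⟨ cong (λ z → m * (N * energy ℓ + z)) (sym (*-assoc 2 (K * K) _)) ⟩
    m * (N * energy ℓ + 2 * (K * K) * (N ^ ℓ * N ^ ℓ)) ∎
    where
    G = rowDot p (multiplicity<N ℓ)

-- The paper's bound I_ℓ ≪ N^(2ℓ - 1 + 2^-ℓ), raised to the power M = 2^ℓ and multiplied by N^M
-- so that it also makes sense for ℓ = 0.
EnergyBound : ℕ → ℕ → Set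
EnergyBound ℓ C = ∀ p .{{_ : NonZero p}} → Prime p → ∀ H N → H + N < p →
                  I ℓ p H N ^ (2 ^ ℓ) * N ^ (2 ^ ℓ) ≤ C * (N ^ ℓ) ^ (2 * 2 ^ ℓ) * N

energy-bound : ∀ ℓ → ∃[ C ] EnergyBound ℓ C
energy-bound zero = 1 , bound₀
  where
  bound₀ : EnergyBound 0 1
  bound₀ p p-prime H N H+N<p = ≤-reflexive (begin-equality
    I 0 p H N ^ 1 * N ^ 1  ≡⟨ cong (λ J → J ^ 1 * N ^ 1) (trans (I≡energy 0) energy-zero) ⟩
    1 ^ 1 * N ^ 1          ≡⟨ trans (*-identityˡ (N ^ 1)) (*-identityʳ N) ⟩
    N                      ≡⟨ sym (*-identityˡ N) ⟩
    1 * 1 ^ 2 * N          ∎)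
    where open Energy p p-prime H N H+N<p
energy-bound (suc ℓ) with energy-bound ℓ
... | C , bound = step-constant (2 ^ ℓ) C , bound′
  where
  M = 2 ^ suc ℓ
  bound′ : EnergyBound (suc ℓ) (step-constant (2 ^ ℓ) C)
  bound′ p p-prime H zero _ = ≤-trans (≤-reflexive I^M*0^M≡0) z≤n
    where
    I^M*0^M≡0 : I (suc ℓ) p H 0 ^ M * 0 ^ M ≡ 0
    I^M*0^M≡0 = trans (cong (I (suc ℓ) p H 0 ^ M *_) (0^n≡0 M {{m^n≢0 2 (suc ℓ)}})) (*-zeroʳ (I (suc ℓ) p H 0 ^ M))
  bound′ p p-prime H N@(suc _) H+N<p =
    bound-step (2 ^ ℓ) C N (N ^ ℓ) (I ℓ p H N) (I (suc ℓ) p H N) {{m^n≢0 2 ℓ}} (bound p p-prime H N H+N<p) recurrence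
    where
    open Energy p p-prime H N H+N<p
    recurrence : ∀ m K → N ≤ m * K → I (suc ℓ) p H N ≤ m * (N * I ℓ p H N + 2 * (K * K) * (N ^ ℓ * N ^ ℓ))
    recurrence m K N≤mK rewrite I≡energy ℓ | I≡energy (suc ℓ) = energy-suc≤ ℓ m K N≤mK

theorem6 : ∀ (ℓ : ℕ) → 1 ≤ ℓ → ∃[ C ] (∀ (p : ℕ) .{{_ : NonZero p}} → Prime p → p ≢ 2 →
             ∀ (H N : ℕ) → H + N < p →
             I ℓ p H N ^ (2 ^ ℓ) ≤ C * N ^ ((2 * ℓ ∸ 1) * 2 ^ ℓ + 1))
theorem6 (suc ℓ) _ with energy-bound (suc ℓ)
... | C , bound = C , bound′
  where
  M = 2 ^ suc ℓ
  -- The argument does not use that p is odd.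
  bound′ : ∀ p .{{_ : NonZero p}} → Prime p → p ≢ 2 → ∀ H N → H + N < p →
           I (suc ℓ) p H N ^ M ≤ C * N ^ ((2 * suc ℓ ∸ 1) * M + 1)
  -- Over the empty interval there are no tuples, so I (suc ℓ) p H 0 reduces to 0.
  bound′ p p-prime _ H zero      _     = ≤-trans (≤-reflexive (0^n≡0 M {{m^n≢0 2 (suc ℓ)}})) z≤n
  bound′ p p-prime _ H N@(suc _) H+N<p = *-cancelʳ-≤ _ _ (N ^ M) {{m^n≢0 N M}} (begin
    I (suc ℓ) p H N ^ M * N ^ M                   ≤⟨ bound p p-prime H N H+N<p ⟩
    C * (N ^ suc ℓ) ^ (2 * M) * N                 ≡⟨ *-assoc C _ N ⟩
    C * ((N ^ suc ℓ) ^ (2 * M) * N)               ≡⟨ cong (C *_) ([n^[1+ℓ]]^[2M]*n≡n^[[2[1+ℓ]∸1]M+1]*n^M N ℓ M) ⟩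
    C * (N ^ ((2 * suc ℓ ∸ 1) * M + 1) * N ^ M)   ≡⟨ sym (*-assoc C _ _) ⟩
    C * N ^ ((2 * suc ℓ ∸ 1) * M + 1) * N ^ M     ∎)
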